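{- Let $G\in\mathcal{R}(\mathcal{C})$ and let $e\in E(G)$ be an edge that lies in at most one triangle of $G$. Then $G/e\in\mathcal{R}(\mathcal{C})$, where $G/e$ is the graph obtained from $G$ by contracting $e$.
   Context: All graphs are finite and simple; contraction of an edge produces a simple graph (parallel edges merged, no loops). $\mathcal{R}(\mathcal{C})$ is the class of graphs $G$ such that every $2$-colouring of the edges of $G$ admits a monochromatic cycle (of any length). -}

module Defs where

open import Data.Nat using (ℕ; zero; suc)
open import Data.Bool using (Bool; true; false; T; not; _∧_; _∨_)
open import Data.Bool.Properties using (∨-comm)
open import Data.Fin using (Fin; zero; suc; inject₁; fromℕ; punchOut; _≟_)
open import Data.List using (allFin)
open import Data.Bool.ListAction using (any)
open import Data.Product using (Σ; _×_; _,_)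
open import Data.Empty using (⊥-elim)
open import Function.Definitions using (Injective)
open import Relation.Nullary using (yes; no; ¬_)
open import Relation.Nullary.Decidable using (⌊_⌋)
open import Relation.Binary.PropositionalEquality using (_≡_; _≢_; refl; sym; cong)

record Graph (n : ℕ) : Set where
  field
    adj    : Fin n → Fin n → Bool
    adjSym : ∀ x y → adj x y ≡ adj y x
    irrefl : ∀ x → adj x x ≡ false
open Graph public

Edge : ∀ {n} → Graph n → Fin n → Fin n → Set
Edge G x y = T (adj G x y)

edge⇒≢ : ∀ {n} (G : Graph n) {u v : Fin n} → Edge G u v → u ≢ v
edge⇒≢ G {u} e refl with adj G u u | irrefl G u
... | .false | refl = e

-- The vertex v is merged into u; the vertices of G/e are Fin n, via the
-- surjection π below (removing v and renumbering).  Two distinct vertices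
-- of G/e are adjacent iff some edge of G joins their preimages
-- (so parallel edges are merged and the loop from e disappears).

module _ {n : ℕ} (G : Graph (suc n)) (u v : Fin (suc n)) (e : Edge G u v) where

  contractMap : Fin (suc n) → Fin n
  contractMap w with v ≟ w
  ... | yes _   = punchOut {i = v} {j = u} (λ p → edge⇒≢ G e (sym p))
  ... | no v≢w  = punchOut {i = v} {j = w} v≢w

  private
    eqb : Fin n → Fin n → Bool
    eqb x y = ⌊ x ≟ y ⌋

    eqb-sym : ∀ x y → eqb x y ≡ eqb y x
    eqb-sym x y with x ≟ y | y ≟ x
    ... | yes _ | yes _ = refl
    ... | no _  | no _  = refl
    ... | yes p | no q  = ⊥-elim (q (sym p))
    ... | no p  | yes q = ⊥-elim (p (sym q))

    eqb-refl : ∀ x → eqb x x ≡ true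
    eqb-refl x with x ≟ x
    ... | yes _ = refl
    ... | no p  = ⊥-elim (p refl)

    H : Fin n → Fin n → Bool
    H x y = any (λ a → any (λ b → eqb (contractMap a) x ∧ (eqb (contractMap b) y ∧ adj G a b))
                           (allFin (suc n)))
                (allFin (suc n))

    cadj : Fin n → Fin n → Bool
    cadj x y = not (eqb x y) ∧ (H x y ∨ H y x)

    cadj-sym : ∀ x y → cadj x y ≡ cadj y x
    cadj-sym x y rewrite eqb-sym x y | ∨-comm (H x y) (H y x) = refl

    cadj-irr : ∀ x → cadj x x ≡ false
    cadj-irr x rewrite eqb-refl x = refl

  contract : Graph n
  contract = record { adj = cadj ; adjSym = cadj-sym ; irrefl = cadj-irr }

-- 2-colourings of the edges: a symmetric assignment of a colour (Bool) to
-- each pair of vertices (only the values on edges matter).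

record Colouring {n : ℕ} (G : Graph n) : Set where
  field
    col    : Fin n → Fin n → Bool
    colSym : ∀ x y → col x y ≡ col y x
open Colouring public

record MonoCycle {n : ℕ} (G : Graph n) (χ : Colouring G) : Set where
  field
    m      : ℕ
    verts  : Fin (suc (suc (suc m))) → Fin n
    inj    : Injective _≡_ _≡_ verts
    colour : Bool
    step   : ∀ (i : Fin (suc (suc m))) →
               Edge G (verts (inject₁ i)) (verts (suc i))
               × col χ (verts (inject₁ i)) (verts (suc i)) ≡ colour
    close  : Edge G (verts (fromℕ (suc (suc m)))) (verts zero)
               × col χ (verts (fromℕ (suc (suc m)))) (verts zero) ≡ colour

InRC : ∀ {n} → Graph n → Set
InRC G = (χ : Colouring G) → MonoCycle G χ

AtMostOneTriangle : ∀ {n} (G : Graph n) → Fin n → Fin n → Set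
AtMostOneTriangle G u v =
  ∀ w w' → Edge G u w → Edge G v w → Edge G u w' → Edge G v w' → w ≡ w'

-- Pull a colouring of G/e back along the contraction map π : V(G) → V(G/e), giving e
-- the colour opposite to that of vw, where uvw is the unique triangle on e (if any).
-- A monochromatic cycle of G that misses u or v maps injectively onto one of G/e.
-- Otherwise it splits at u and v into two arcs; an arc with at least two inner
-- vertices closes up in G/e because π u ≡ π v.  If both arcs are short, the cycle is
-- either the triangle uvw, which is not monochromatic by the choice of colour of e,
-- or a 4-cycle uwvw′, which would put two triangles on e.

module Submission where

open import Defs
open import Data.Nat using (ℕ; zero; suc; _≤_; s≤s; z≤n)
open import Data.Nat.Properties using (suc-injective)
open import Data.Bool using (Bool; true; T; not; _∧_)
open import Data.Bool.Properties using (T-∧; T-∨; not-¬)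
open import Data.Fin using (Fin; zero; suc; inject₁; fromℕ; _≟_)
open import Data.Fin.Properties using (punchOut-injective; punchOut-cong; any?)
open import Data.Bool.ListAction using (any)
open import Data.List using (List; []; _∷_; _++_; [_]; map; length; lookup; tabulate; allFin)
open import Data.List.Properties using (++-assoc; map-++; length-map; length-tabulate)
open import Data.List.Relation.Unary.All as All using ([]; _∷_)
open import Data.List.Relation.Unary.All.Properties using (¬Any⇒All¬; ++⁻ˡ) renaming (map⁺ to All-map⁺)
open import Data.List.Relation.Unary.Any using (here; there)
open import Data.List.Relation.Unary.Any.Properties using (any⁺)
open import Data.List.Relation.Unary.AllPairs using ([]; _∷_)
open import Data.List.Relation.Unary.Linked as Linked using (Linked; [-]; _∷_)
open import Data.List.Relation.Unary.Linked.Properties using (AllPairs⇒Linked) renaming (map⁺ to Linked-map⁺; map⁻ to Linked-map⁻)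
open import Data.List.Relation.Unary.Unique.Propositional using (Unique)
open import Data.List.Relation.Unary.Unique.Propositional.Properties using (tabulate⁺)
open import Data.List.Relation.Binary.Permutation.Propositional using (_↭_; ↭⇒↭ₛ)
open import Data.List.Relation.Binary.Permutation.Propositional.Properties using (++-comm; ↭-length)
import Data.List.Relation.Binary.Permutation.Setoid.Properties as Permutationₛ
open import Data.List.Membership.Propositional using (_∈_; _∉_; lose)
open import Data.List.Membership.Propositional.Properties using (∈-∃++; ∈-lookup; ∈-allFin)
open import Data.Product using (_×_; _,_; proj₁; proj₂; ∃)
open import Data.Sum using (_⊎_; inj₁; inj₂)
open import Data.Empty using (⊥; ⊥-elim)
open import Function using (_∘_; Equivalence)
open import Relation.Nullary using (yes; no; Dec)
open import Relation.Nullary.Decidable using (⌊_⌋; T?; _×-dec_; fromWitness; fromWitnessFalse)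
open import Relation.Binary.PropositionalEquality using (_≡_; _≢_; refl; sym; trans; cong; subst; setoid; module ≡-Reasoning)

module _ {A : Set} where

  unique-resp-↭ : {xs ys : List A} → xs ↭ ys → Unique xs → Unique ys
  unique-resp-↭ σ = Permutationₛ.Unique-resp-↭ (setoid A) (↭⇒↭ₛ σ)

  unique-prefix : ∀ xs {ys : List A} → Unique (xs ++ ys) → Unique xs
  unique-prefix []       _          = []
  unique-prefix (x ∷ xs) (x∉ ∷ xs!) = ++⁻ˡ xs x∉ ∷ unique-prefix xs xs!

  unique-arc : ∀ xs {y : A} {ys} → Unique (xs ++ y ∷ ys) → Unique (y ∷ xs)
  unique-arc xs {y} {ys} xs! =
    unique-resp-↭ (++-comm xs [ y ])
      (unique-prefix (xs ++ [ y ]) (subst Unique (sym (++-assoc xs [ y ] ys)) xs!))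

  lookup-injective : ∀ {xs : List A} → Unique xs → ∀ {i j} → lookup xs i ≡ lookup xs j → i ≡ j
  lookup-injective (_  ∷ _)   {zero}  {zero}  _  = refl
  lookup-injective (x∉ ∷ _)   {zero}  {suc j} eq = ⊥-elim (All.lookup x∉ (∈-lookup j) eq)
  lookup-injective (x∉ ∷ _)   {suc i} {zero}  eq = ⊥-elim (All.lookup x∉ (∈-lookup i) (sym eq))
  lookup-injective (_  ∷ xs!) {suc i} {suc j} eq = cong suc (lookup-injective xs! eq)

  unique-closed-walk : ∀ {y z : A} {zs} → Unique (y ∷ z ∷ zs) → Linked _≢_ (y ∷ z ∷ zs ++ [ y ])
  unique-closed-walk {y} {z} {zs} xs!@((y≢z ∷ _) ∷ _) =
    y≢z ∷ AllPairs⇒Linked (unique-resp-↭ (++-comm [ y ] (z ∷ zs)) xs!)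

module _ {A B : Set} (f : A → B) where

  unique-map-avoiding : ∀ {w xs} → (∀ {a b} → w ≢ a → w ≢ b → f a ≡ f b → a ≡ b) →
    Unique (w ∷ xs) → Unique (map f xs)
  unique-map-avoiding {xs = []}     _   _ = []
  unique-map-avoiding {xs = x ∷ xs} inj ((w≢x ∷ w≢xs) ∷ x≢xs ∷ xs!) =
    All-map⁺ (All.zipWith (λ (w≢y , x≢y) → x≢y ∘ inj w≢x w≢y) (w≢xs , x≢xs))
    ∷ unique-map-avoiding inj (w≢xs ∷ xs!)

module _ {A : Set} {R : A → A → Set} where

  linked-split : ∀ xs {y ys} → Linked R (xs ++ y ∷ ys) → Linked R (xs ++ [ y ]) × Linked R (y ∷ ys)
  linked-split []            l       = [-] , l
  linked-split (x ∷ [])      (r ∷ l) = r ∷ [-] , l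
  linked-split (x ∷ x′ ∷ xs) (r ∷ l) with linked-split (x′ ∷ xs) l
  ... | l₁ , l₂ = r ∷ l₁ , l₂

  linked-glue : ∀ xs {y ys} → Linked R (xs ++ [ y ]) → Linked R (y ∷ ys) → Linked R (xs ++ y ∷ ys)
  linked-glue []            _        l = l
  linked-glue (x ∷ [])      (r ∷ _)  l = r ∷ l
  linked-glue (x ∷ x′ ∷ xs) (r ∷ l₁) l = r ∷ linked-glue (x′ ∷ xs) l₁ l

  linked-tabulate : ∀ k (f : Fin (suc k) → A) {z} → (∀ i → R (f (inject₁ i)) (f (suc i))) →
    R (f (fromℕ k)) z → Linked R (tabulate f ++ [ z ])
  linked-tabulate zero    f steps last = last ∷ [-]
  linked-tabulate (suc k) f steps last = steps zero ∷ linked-tabulate k (f ∘ suc) (steps ∘ suc) last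

  linked-lookup : ∀ {y} ys {z} → Linked R (y ∷ ys ++ [ z ]) →
    (∀ i → R (lookup (y ∷ ys) (inject₁ i)) (lookup (y ∷ ys) (suc i)))
    × R (lookup (y ∷ ys) (fromℕ (length ys))) z
  linked-lookup []       (r ∷ [-]) = (λ ()) , r
  linked-lookup (_ ∷ ys) (r ∷ l) with linked-lookup ys l
  ... | steps , last = (λ { zero → r ; (suc i) → steps i }) , last

record Cycle {A : Set} (R : A → A → Set) (x : A) : Set where
  constructor cycle
  field
    rest     : List A
    long     : 2 ≤ length rest
    closed   : Linked R (x ∷ rest ++ [ x ])
    distinct : Unique (x ∷ rest)

module _ {A : Set} {R : A → A → Set} where

  rotate-closed-walk : ∀ p P {y} S →
    Linked R (p ∷ (P ++ y ∷ S) ++ [ p ]) → Linked R (y ∷ (S ++ p ∷ P) ++ [ y ])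
  rotate-closed-walk p P {y} S walk
    with linked-split (p ∷ P) (subst (λ t → Linked R (p ∷ t)) (++-assoc P (y ∷ S) [ p ]) walk)
  ... | arc₁ , arc₂ =
    subst (λ t → Linked R (y ∷ t)) (sym (++-assoc S (p ∷ P) [ y ])) (linked-glue (y ∷ S) arc₂ arc₁)

  rotate : ∀ {x y} (C : Cycle R x) → y ∈ x ∷ Cycle.rest C → Cycle R y
  rotate (cycle rest long closed distinct) y∈ with ∈-∃++ y∈
  ... | [] , S , refl = cycle S long closed distinct
  ... | p ∷ P , S , refl =
    cycle (S ++ p ∷ P) (subst (2 ≤_) (suc-injective (↭-length σ)) long)
      (rotate-closed-walk p P S closed) (unique-resp-↭ σ distinct)
    where σ = ++-comm (p ∷ P) (_ ∷ S)

cycle-image : ∀ {A B : Set} {R : A → A → Set} {S : B → B → Set} (f : A → B) →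
  (∀ {a b} → f a ≢ f b → R a b → S (f a) (f b)) →
  ∀ {x x′ xs} → f x′ ≡ f x → 2 ≤ length xs → Linked R (x ∷ xs ++ [ x′ ]) →
  Unique (map f (x ∷ xs)) → Cycle S (f x)
cycle-image f step {xs = []}    _ () _ _
cycle-image {S = S} f step {x} {x′} {xs@(_ ∷ _)} fx′≡fx long walk image! =
  cycle (map f xs) (subst (2 ≤_) (sym (length-map f xs)) long) image-closed image!
  where
  image-walk : map f (x ∷ xs ++ [ x′ ]) ≡ f x ∷ map f xs ++ [ f x ]
  image-walk = cong (f x ∷_) (trans (map-++ f xs [ x′ ]) (cong (λ z → map f xs ++ [ z ]) fx′≡fx))

  image-distinct-steps : Linked (λ a b → f a ≢ f b) (x ∷ xs ++ [ x′ ])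
  image-distinct-steps = Linked-map⁻ (subst (Linked _≢_) (sym image-walk) (unique-closed-walk image!))

  image-closed : Linked S (f x ∷ map f xs ++ [ f x ])
  image-closed = subst (Linked S) image-walk
    (Linked-map⁺ (Linked.zipWith (λ (fa≢fb , r) → step fa≢fb r) (image-distinct-steps , walk)))

edge-sym : ∀ {n} (G : Graph n) {p q} → Edge G p q → Edge G q p
edge-sym G {p} {q} = subst T (adjSym G p q)

MonoEdge : ∀ {n} (G : Graph n) → Colouring G → Bool → Fin n → Fin n → Set
MonoEdge G χ c p q = Edge G p q × col χ p q ≡ c

monoEdge-sym : ∀ {n} (G : Graph n) χ {c p q} → MonoEdge G χ c p q → MonoEdge G χ c q p
monoEdge-sym G χ {p = p} {q} (e , c) = edge-sym G e , trans (colSym χ q p) c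

monoCycle⇒cycle : ∀ {n} {G : Graph n} {χ} (C : MonoCycle G χ) →
  Cycle (MonoEdge G χ (MonoCycle.colour C)) (MonoCycle.verts C zero)
monoCycle⇒cycle C = cycle (tabulate (verts ∘ suc))
  (subst (2 ≤_) (sym (length-tabulate (verts ∘ suc))) (s≤s (s≤s z≤n)))
  (linked-tabulate (suc (suc m)) verts step close) (tabulate⁺ inj)
  where open MonoCycle C

cycle⇒monoCycle : ∀ {n} {G : Graph n} {χ c x} → Cycle (MonoEdge G χ c) x → MonoCycle G χ
cycle⇒monoCycle {c = c} {x} (cycle (x₁ ∷ x₂ ∷ xs) _ closed distinct) = record
  { m      = length xs
  ; verts  = lookup (x ∷ x₁ ∷ x₂ ∷ xs)
  ; inj    = lookup-injective distinct
  ; colour = c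
  ; step   = proj₁ (linked-lookup (x₁ ∷ x₂ ∷ xs) closed)
  ; close  = proj₂ (linked-lookup (x₁ ∷ x₂ ∷ xs) closed)
  }
cycle⇒monoCycle (cycle (_ ∷ []) (s≤s ()) _ _)

module Contraction {n : ℕ} (G : Graph (suc n)) (u v : Fin (suc n)) (e : Edge G u v) where

  G′ : Graph n
  G′ = contract G u v e

  π : Fin (suc n) → Fin n
  π = contractMap G u v e

  open import Data.List.Membership.DecPropositional (_≟_ {n = suc n}) using (_∈?_)

  π-collapses-only-e : ∀ {a b} → π a ≡ π b → a ≡ b ⊎ (a ≡ u × b ≡ v) ⊎ (a ≡ v × b ≡ u)
  π-collapses-only-e {a} {b} eq with v ≟ a | v ≟ b
  ... | yes v≡a | yes v≡b = inj₁ (trans (sym v≡a) v≡b)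
  ... | yes v≡a | no  v≢b = inj₂ (inj₂ (sym v≡a , sym (punchOut-injective _ v≢b eq)))
  ... | no  v≢a | yes v≡b = inj₂ (inj₁ (punchOut-injective v≢a _ eq , sym v≡b))
  ... | no  v≢a | no  v≢b = inj₁ (punchOut-injective v≢a v≢b eq)

  π-identifies-e : π u ≡ π v
  π-identifies-e with v ≟ u | v ≟ v
  ... | yes v≡u | _       = ⊥-elim (edge⇒≢ G e (sym v≡u))
  ... | no  _   | yes _   = punchOut-cong v refl
  ... | no  _   | no  v≢v = ⊥-elim (v≢v refl)

  π-injective-avoiding : ∀ {w a b} → w ≡ u ⊎ w ≡ v → w ≢ a → w ≢ b → π a ≡ π b → a ≡ b
  π-injective-avoiding w-end w≢a w≢b eq with π-collapses-only-e eq | w-end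
  ... | inj₁ a≡b                  | _         = a≡b
  ... | inj₂ (inj₁ (refl , refl)) | inj₁ refl = ⊥-elim (w≢a refl)
  ... | inj₂ (inj₁ (refl , refl)) | inj₂ refl = ⊥-elim (w≢b refl)
  ... | inj₂ (inj₂ (refl , refl)) | inj₁ refl = ⊥-elim (w≢b refl)
  ... | inj₂ (inj₂ (refl , refl)) | inj₂ refl = ⊥-elim (w≢a refl)

  -- must coincide with the search for a preimage edge inside the definition of contract
  joins : Fin n → Fin n → Fin (suc n) → Fin (suc n) → Bool
  joins x y a b = ⌊ π a ≟ x ⌋ ∧ (⌊ π b ≟ y ⌋ ∧ adj G a b)

  contract-edge : ∀ {p q} → π p ≢ π q → Edge G p q → Edge G′ (π p) (π q)
  contract-edge {p} {q} πp≢πq epq =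
    Equivalence.from T-∧ (fromWitnessFalse {a? = π p ≟ π q} πp≢πq , Equivalence.from T-∨ (inj₁ preimage-edge))
    where
    joins-pq : T (joins (π p) (π q) p q)
    joins-pq = Equivalence.from T-∧
      (fromWitness {a? = π p ≟ π p} refl , Equivalence.from T-∧ (fromWitness {a? = π q ≟ π q} refl , epq))

    preimage-edge : T (any (λ a → any (joins (π p) (π q) a) (allFin (suc n))) (allFin (suc n)))
    preimage-edge = any⁺ _ (lose (∈-allFin p) (any⁺ _ (lose (∈-allFin q) joins-pq)))

  CommonNeighbour : Fin (suc n) → Set
  CommonNeighbour w = Edge G u w × Edge G v w

  common-neighbour? : Dec (∃ CommonNeighbour)
  common-neighbour? = any? (λ w → T? (adj G u w) ×-dec T? (adj G v w))

  module Lift (tri : AtMostOneTriangle G u v) (χ′ : Colouring G′) where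

    e-colour : Dec (∃ CommonNeighbour) → Bool
    e-colour (yes (w , _)) = not (col χ′ (π v) (π w))
    e-colour (no _)        = true

    e-colour-breaks-triangle : ∀ d {w} → CommonNeighbour w → e-colour d ≢ col χ′ (π v) (π w)
    e-colour-breaks-triangle (yes (w₀ , euw₀ , evw₀)) {w} (euw , evw)
      with tri w₀ w euw₀ evw₀ euw evw
    ... | refl = λ eq → not-¬ refl (sym eq)
    e-colour-breaks-triangle (no ∄w) cn = ⊥-elim (∄w (_ , cn))

    lift : Fin (suc n) → Fin (suc n) → Bool
    lift p q with π p ≟ π q
    ... | yes _ = e-colour common-neighbour?
    ... | no  _ = col χ′ (π p) (π q)

    lift-sym : ∀ p q → lift p q ≡ lift q p
    lift-sym p q with π p ≟ π q | π q ≟ π p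
    ... | yes _   | yes _   = refl
    ... | no  _   | no  _   = colSym χ′ (π p) (π q)
    ... | yes eq  | no  ne  = ⊥-elim (ne (sym eq))
    ... | no  ne  | yes eq  = ⊥-elim (ne (sym eq))

    lift-e : lift u v ≡ e-colour common-neighbour?
    lift-e with π u ≟ π v
    ... | yes _ = refl
    ... | no ne = ⊥-elim (ne π-identifies-e)

    lift-off-e : ∀ {p q} → π p ≢ π q → lift p q ≡ col χ′ (π p) (π q)
    lift-off-e {p} {q} ne with π p ≟ π q
    ... | yes eq = ⊥-elim (ne eq)
    ... | no  _  = refl

    χ : Colouring G
    χ = record { col = lift ; colSym = lift-sym }

    no-mono-triangle : ∀ {c w} → MonoEdge G χ c u v → MonoEdge G χ c v w → MonoEdge G χ c w u → ⊥
    no-mono-triangle {c} {w} (_ , uv-c) (evw , vw-c) (ewu , _) =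
      e-colour-breaks-triangle common-neighbour? (euw , evw) (begin
        e-colour common-neighbour?  ≡⟨ sym lift-e ⟩
        lift u v                    ≡⟨ uv-c ⟩
        c                           ≡⟨ sym vw-c ⟩
        lift v w                    ≡⟨ lift-off-e πv≢πw ⟩
        col χ′ (π v) (π w)          ∎)
      where
      open ≡-Reasoning
      euw : Edge G u w
      euw = edge-sym G ewu
      πv≢πw : π v ≢ π w
      πv≢πw = edge⇒≢ G evw ∘ π-injective-avoiding (inj₁ refl) (edge⇒≢ G e) (edge⇒≢ G euw)

    module _ (c : Bool) where

      R : Fin (suc n) → Fin (suc n) → Set
      R = MonoEdge G χ c

      R′ : Fin n → Fin n → Set
      R′ = MonoEdge G′ χ′ c

      contract-step : ∀ {p q} → π p ≢ π q → R p q → R′ (π p) (π q)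
      contract-step ne (epq , c-pq) = contract-edge ne epq , trans (sym (lift-off-e ne)) c-pq

      cycle-avoiding : ∀ {w x} (C : Cycle R x) → w ≡ u ⊎ w ≡ v → w ∉ x ∷ Cycle.rest C → ∃ (Cycle R′)
      cycle-avoiding (cycle rest long closed distinct) w-end w∉ =
        _ , cycle-image π contract-step refl long closed
              (unique-map-avoiding π (π-injective-avoiding w-end) (¬Any⇒All¬ _ w∉ ∷ distinct))

      cycle-from-arcs : ∀ A B → 2 ≤ length (A ++ v ∷ B) →
        Linked R (u ∷ A ++ [ v ]) → Linked R (v ∷ B ++ [ u ]) → Unique (u ∷ A ++ v ∷ B) → ∃ (Cycle R′)
      cycle-from-arcs A@(_ ∷ _ ∷ _) B _ arcᵤᵥ _ distinct =
        _ , cycle-image π contract-step (sym π-identifies-e) (s≤s (s≤s z≤n)) arcᵤᵥ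
              (unique-map-avoiding π (π-injective-avoiding (inj₂ refl)) (unique-arc (u ∷ A) distinct))
      cycle-from-arcs A B@(_ ∷ _ ∷ _) _ _ arcᵥᵤ distinct =
        _ , cycle-image π contract-step π-identifies-e (s≤s (s≤s z≤n)) arcᵥᵤ
              (unique-map-avoiding π (π-injective-avoiding (inj₁ refl))
                (unique-arc (v ∷ B) (unique-resp-↭ (++-comm (u ∷ A) (v ∷ B)) distinct)))
      cycle-from-arcs [] [] (s≤s ()) _ _ _
      cycle-from-arcs (w ∷ []) [] _ (uw ∷ wv ∷ [-]) (vu ∷ [-]) _ =
        ⊥-elim (no-mono-triangle (monoEdge-sym G χ vu) (monoEdge-sym G χ wv) (monoEdge-sym G χ uw))
      cycle-from-arcs [] (w ∷ []) _ (uv ∷ [-]) (vw ∷ wu ∷ [-]) _ =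
        ⊥-elim (no-mono-triangle uv vw wu)
      cycle-from-arcs (w ∷ []) (w′ ∷ []) _ ((euw , _) ∷ (ewv , _) ∷ [-]) ((evw′ , _) ∷ (ew′u , _) ∷ [-])
        (_ ∷ (_ ∷ w≢w′ ∷ []) ∷ _) =
        ⊥-elim (w≢w′ (tri w w′ euw (edge-sym G ewv) (edge-sym G ew′u) evw′))

      cycle-through-e : ∀ A B → 2 ≤ length (A ++ v ∷ B) →
        Linked R (u ∷ (A ++ v ∷ B) ++ [ u ]) → Unique (u ∷ A ++ v ∷ B) → ∃ (Cycle R′)
      cycle-through-e A B long walk distinct
        with linked-split (u ∷ A) (subst (λ t → Linked R (u ∷ t)) (++-assoc A (v ∷ B) [ u ]) walk)
      ... | arcᵤᵥ , arcᵥᵤ = cycle-from-arcs A B long arcᵤᵥ arcᵥᵤ distinct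

      cycle-through-u : Cycle R u → ∃ (Cycle R′)
      cycle-through-u C@(cycle rest long closed distinct) with v ∈? rest
      ... | no v∉ = cycle-avoiding C (inj₂ refl) λ { (here v≡u) → edge⇒≢ G e (sym v≡u) ; (there v∈) → v∉ v∈ }
      ... | yes v∈ with ∈-∃++ v∈
      ... | A , B , refl = cycle-through-e A B long closed distinct

      contract-cycle : ∀ {x} → Cycle R x → ∃ (Cycle R′)
      contract-cycle C@(cycle rest _ _ _) with u ∈? _ ∷ rest
      ... | no  u∉ = cycle-avoiding C (inj₁ refl) u∉
      ... | yes u∈ = cycle-through-u (rotate C u∈)

lemma2p2 : (n : ℕ) (G : Graph (suc n)) (u v : Fin (suc n)) (e : Edge G u v) →
    InRC G → AtMostOneTriangle G u v → InRC (contract G u v e)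
lemma2p2 n G u v e G∈RC tri χ′ =
  cycle⇒monoCycle (proj₂ (contract-cycle _ (monoCycle⇒cycle (G∈RC χ))))
  where
  open Contraction G u v e
  open Lift tri χ′
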